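{- Let $p$ be a propositional variable. There is no formula $\varphi\in\mathsf L_{\mathsf U}$ such that $\Box p\leftrightarrow\varphi$ is valid over the class of finite here-and-there models.
   Context: $\mathsf L_{\mathsf U}$: formulas built from variables and $\bot$ using $\wedge,\vee,\to,\bigcirc,\mathsf U$. A model is $(W,\preccurlyeq,S,V)$ with $\preccurlyeq$ a partial order on nonempty $W$, $S\colon W\to W$ forward confluent ($w\preccurlyeq v\Rightarrow S(w)\preccurlyeq S(v)$), and monotone $V\colon W\to\mathcal P(\mathbb P)$. Satisfaction: atoms by $V$; $\bot$ false; $\wedge,\vee$ classical; $w\models\bigcirc\varphi$ iff $S(w)\models\varphi$; $w\models\varphi\to\psi$ iff every $v\succcurlyeq w$ with $v\models\varphi$ has $v\models\psi$; $w\models\Box\varphi$ iff $S^k(w)\models\varphi$ for all $k\ge0$; $w\models\varphi\,\mathsf U\,\psi$ iff some $k\ge0$ has $S^k(w)\models\psi$ and $S^i(w)\models\varphi$ for all $i<k$. A here-and-there model is a model with $W=T\times\{0,1\}$ for some set $T$ such that there is $f\colon T\to T$ with $(t,i)\preccurlyeq(s,j)$ iff $t=s$ and $i\le j$, and $S(t,i)=(f(t),i)$. It is finite if $W$ is finite. -}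

module Defs where

open import Data.Nat using (ℕ; zero; suc; _<_)
open import Data.Fin using (Fin)
open import Data.Bool using (Bool; true; false) renaming (_≤_ to _≤B_)
open import Data.Bool using (b≤b; f≤t)
open import Data.Product using (Σ; _×_; _,_; proj₁; proj₂)
open import Data.Sum using (_⊎_)
open import Data.Empty using (⊥)
open import Relation.Binary.PropositionalEquality using (_≡_; refl; trans; cong)
open import Relation.Binary.Structures using (IsPartialOrder)
open import Relation.Binary.PropositionalEquality.Properties using (isEquivalence)
import Data.Bool.Properties as BP

Var : Set
Var = ℕ

-- The full temporal language (with □, so that □p ↔ φ can be written).
infixr 5 _⇒_
infixr 6 _∨'_
infixr 7 _∧'_
infixr 8 _𝒰_
data Form : Set where
  var  : Var → Form
  ⊥'   : Form
  _∧'_ : Form → Form → Form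
  _∨'_ : Form → Form → Form
  _⇒_  : Form → Form → Form
  ○    : Form → Form
  □    : Form → Form
  _𝒰_  : Form → Form → Form

_⇔_ : Form → Form → Form
φ ⇔ ψ = (φ ⇒ ψ) ∧' (ψ ⇒ φ)

data InLU : Form → Set where
  var  : ∀ x → InLU (var x)
  ⊥'   : InLU ⊥'
  _∧'_ : ∀ {φ ψ} → InLU φ → InLU ψ → InLU (φ ∧' ψ)
  _∨'_ : ∀ {φ ψ} → InLU φ → InLU ψ → InLU (φ ∨' ψ)
  _⇒_  : ∀ {φ ψ} → InLU φ → InLU ψ → InLU (φ ⇒ ψ)
  ○    : ∀ {φ} → InLU φ → InLU (○ φ)
  _𝒰_  : ∀ {φ ψ} → InLU φ → InLU ψ → InLU (φ 𝒰 ψ)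

iter : {A : Set} → (A → A) → ℕ → A → A
iter f zero    a = a
iter f (suc k) a = f (iter f k a)

record Model : Set₁ where
  field
    W        : Set
    w₀       : W
    _≼_      : W → W → Set
    ≼-po     : IsPartialOrder _≡_ _≼_
    S        : W → W
    S-conf   : ∀ {w v} → w ≼ v → S w ≼ S v
    V        : W → Var → Set
    V-mono   : ∀ {w v x} → w ≼ v → V w x → V v x

module _ (M : Model) where
  open Model M

  _⊨_ : W → Form → Set
  w ⊨ var x    = V w x
  w ⊨ ⊥'       = ⊥
  w ⊨ (φ ∧' ψ) = (w ⊨ φ) × (w ⊨ ψ)
  w ⊨ (φ ∨' ψ) = (w ⊨ φ) ⊎ (w ⊨ ψ)
  w ⊨ (φ ⇒ ψ)  = ∀ v → w ≼ v → v ⊨ φ → v ⊨ ψ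
  w ⊨ ○ φ      = S w ⊨ φ
  w ⊨ □ φ      = ∀ k → iter S k w ⊨ φ
  w ⊨ (φ 𝒰 ψ)  = Σ ℕ λ k → (iter S k w ⊨ ψ) × (∀ i → i < k → iter S i w ⊨ φ)

  Valid : Form → Set
  Valid φ = ∀ w → w ⊨ φ

-- Here-and-there models with T = Fin (suc n) (finite, nonempty).
-- World (t , b): b = false is "here" (0), b = true is "there" (1).
HTW : ℕ → Set
HTW n = Fin (suc n) × Bool

_≼HT_ : ∀ {n} → HTW n → HTW n → Set
(t , i) ≼HT (s , j) = (t ≡ s) × (i ≤B j)

module HTProofs (n : ℕ) where

  po : IsPartialOrder {A = HTW n} _≡_ _≼HT_
  po = record
    { isPreorder = record
      { isEquivalence = isEquivalence
      ; reflexive = λ { refl → refl , BP.≤-refl }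
      ; trans = λ { (p , a) (q , b) → trans p q , BP.≤-trans a b } }
    ; antisym = λ { {t , i} {s , j} (refl , a) (_ , b) → cong (t ,_) (BP.≤-antisym a b) } }

HT : (n : ℕ) (f : Fin (suc n) → Fin (suc n))
     (V : HTW n → Var → Set)
     (V-mono : ∀ t x → V (t , false) x → V (t , true) x) → Model
HT n f V V-mono = record
  { W = HTW n
  ; w₀ = Fin.zero , false
  ; _≼_ = _≼HT_
  ; ≼-po = HTProofs.po n
  ; S = λ { (t , i) → f t , i }
  ; S-conf = λ { (refl , a) → refl , a }
  ; V = V
  ; V-mono = mono
  }
  where
  import Data.Fin as Fin
  mono : ∀ {w v x} → w ≼HT v → V w x → V v x
  mono {t , .false} {.t , .true} (refl , f≤t) h = V-mono t _ h
  mono {t , i} {.t , .i} (refl , b≤b) h = h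

module Submission where

-- Take T = {0,…,N} with f t = min (t+1, N), and let p hold everywhere except at the
-- here-world (N, 0).  Then □p holds at (0, 1) but fails at (0, 0).  An L_U formula
-- cannot see this difference: at there-worlds all of T looks alike, so U collapses to
-- its right argument, and ○ is the only way to move along T; hence a formula of
-- ○-depth d is evaluated identically at (t, 0) and (t, 1) as long as t + d < N.

open import Defs
open import Data.Nat using (ℕ; zero; suc; _+_; _<_; _≤_; _⊔_; _⊓_; s≤s)
open import Data.Nat.Properties
  using (≤-refl; ≤-trans; ≤-<-trans; m+n≤o⇒m≤o; <-irrefl; n≤1+n; +-suc; +-monoˡ-≤; +-monoʳ-≤;
         m≤m⊔n; m≤n⊔m; m⊓n≤m; m⊓n≤n; m≤n⇒m⊓n≡m)
open import Data.Fin using (Fin; toℕ; fromℕ<) renaming (zero to 0F)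
open import Data.Fin.Properties using (toℕ-fromℕ<)
open import Data.Bool using (true; false; b≤b; f≤t)
open import Data.Product using (Σ; _×_; _,_; proj₁; proj₂)
open import Data.Sum using (inj₁; inj₂)
open import Relation.Binary.Structures using (IsPartialOrder)
open import Relation.Nullary using (¬_)
open import Relation.Binary.PropositionalEquality using (_≡_; refl; sym; cong; subst; module ≡-Reasoning)
open ≡-Reasoning

○-depth : Form → ℕ
○-depth (var x)  = 0
○-depth ⊥'       = 0
○-depth (φ ∧' ψ) = ○-depth φ ⊔ ○-depth ψ
○-depth (φ ∨' ψ) = ○-depth φ ⊔ ○-depth ψ
○-depth (φ ⇒ ψ)  = ○-depth φ ⊔ ○-depth ψ
○-depth (○ φ)    = suc (○-depth φ)
○-depth (□ φ)    = ○-depth φ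
○-depth (φ 𝒰 ψ)  = ○-depth φ ⊔ ○-depth ψ

module _ (M : Model) where
  open Model M

  iter-S-mono : ∀ k {w v} → w ≼ v → iter S k w ≼ iter S k v
  iter-S-mono zero    w≼v = w≼v
  iter-S-mono (suc k) w≼v = S-conf (iter-S-mono k w≼v)

  ⊨-mono : ∀ φ {w v} → w ≼ v → _⊨_ M w φ → _⊨_ M v φ
  ⊨-mono (var x)  w≼v h              = V-mono w≼v h
  ⊨-mono (φ ∧' ψ) w≼v (hφ , hψ)      = ⊨-mono φ w≼v hφ , ⊨-mono ψ w≼v hψ
  ⊨-mono (φ ∨' ψ) w≼v (inj₁ hφ)      = inj₁ (⊨-mono φ w≼v hφ)
  ⊨-mono (φ ∨' ψ) w≼v (inj₂ hψ)      = inj₂ (⊨-mono ψ w≼v hψ)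
  ⊨-mono (φ ⇒ ψ)  w≼v h u v≼u        = h u (IsPartialOrder.trans ≼-po w≼v v≼u)
  ⊨-mono (○ φ)    w≼v h              = ⊨-mono φ (S-conf w≼v) h
  ⊨-mono (□ φ)    w≼v h k            = ⊨-mono φ (iter-S-mono k w≼v) (h k)
  ⊨-mono (φ 𝒰 ψ)  w≼v (k , hψ , hφ) =
    k , ⊨-mono ψ (iter-S-mono k w≼v) hψ , λ i i<k → ⊨-mono φ (iter-S-mono i w≼v) (hφ i i<k)

module HTModel (n : ℕ) (f : Fin (suc n) → Fin (suc n)) (V : HTW n → Var → Set)
               (V-mono : ∀ t x → V (t , false) x → V (t , true) x) where

  M : Model
  M = HT n f V V-mono

  _⊩_ : HTW n → Form → Set
  _⊩_ = _⊨_ M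

  iter-S : ∀ k t b → iter (Model.S M) k (t , b) ≡ (iter f k t , b)
  iter-S zero    t b = refl
  iter-S (suc k) t b = cong (Model.S M) (iter-S k t b)

  there-⊩-indep : (∀ t s x → V (t , true) x → V (s , true) x) →
                  ∀ φ t s → (t , true) ⊩ φ → (s , true) ⊩ φ
  there-⊩-indep V-indep = go
    where
    go : ∀ φ t s → (t , true) ⊩ φ → (s , true) ⊩ φ
    go (var x)  t s h                 = V-indep t s x h
    go (φ ∧' ψ) t s (hφ , hψ)         = go φ t s hφ , go ψ t s hψ
    go (φ ∨' ψ) t s (inj₁ hφ)         = inj₁ (go φ t s hφ)
    go (φ ∨' ψ) t s (inj₂ hψ)         = inj₂ (go ψ t s hψ)
    go (φ ⇒ ψ)  t s h (.s , .true) (refl , b≤b) hφ =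
      go ψ t s (h (t , true) (refl , b≤b) (go φ s t hφ))
    go (○ φ)    t s h                 = go φ (f t) (f s) h
    go (□ φ)    t s h k               =
      subst (_⊩ φ) (sym (iter-S k s true)) (go φ t (iter f k s) (h 0))
    go (φ 𝒰 ψ)  t s (k , hψ , _)      =
      0 , go ψ (iter f k t) s (subst (_⊩ ψ) (iter-S k t true) hψ) , λ _ ()

module CounterModel (p : Var) (N : ℕ) where

  step : Fin (suc N) → Fin (suc N)
  step t = fromℕ< {suc (toℕ t) ⊓ N} (s≤s (m⊓n≤n _ N))

  V : HTW N → Var → Set
  V (t , true)  x = x ≡ p
  V (t , false) x = (x ≡ p) × (toℕ t < N)

  V-mono : ∀ t x → V (t , false) x → V (t , true) x
  V-mono t x = proj₁

  open HTModel N step V V-mono public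

  toℕ-step : ∀ t → toℕ (step t) ≡ suc (toℕ t) ⊓ N
  toℕ-step t = toℕ-fromℕ< (s≤s (m⊓n≤n _ N))

  toℕ-step≤ : ∀ t → toℕ (step t) ≤ suc (toℕ t)
  toℕ-step≤ t = subst (_≤ suc (toℕ t)) (sym (toℕ-step t)) (m⊓n≤m _ N)

  toℕ-iter-step : ∀ k → k ≤ N → toℕ (iter step k 0F) ≡ k
  toℕ-iter-step zero    _    = refl
  toℕ-iter-step (suc k) k<N = begin
    toℕ (step (iter step k 0F))    ≡⟨ toℕ-step (iter step k 0F) ⟩
    suc (toℕ (iter step k 0F)) ⊓ N ≡⟨ cong (λ m → suc m ⊓ N) (toℕ-iter-step k (≤-trans (n≤1+n k) k<N)) ⟩
    suc k ⊓ N                            ≡⟨ m≤n⇒m⊓n≡m k<N ⟩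
    suc k                                ∎

  □p-there : (0F , true) ⊩ □ (var p)
  □p-there k = subst (_⊩ var p) (sym (iter-S k 0F true)) refl

  ¬□p-here : ¬ ((0F , false) ⊩ □ (var p))
  ¬□p-here h with subst (_⊩ var p) (iter-S N 0F false) (h N)
  ... | _ , N<N = <-irrefl refl (subst (_< N) (toℕ-iter-step N ≤-refl) N<N)

  ⊔-left : ∀ m {a b} → m + (a ⊔ b) < N → m + a < N
  ⊔-left m = ≤-<-trans (+-monoʳ-≤ m (m≤m⊔n _ _))

  ⊔-right : ∀ m {a b} → m + (a ⊔ b) < N → m + b < N
  ⊔-right m {a} = ≤-<-trans (+-monoʳ-≤ m (m≤n⊔m a _))

  there⇒here : ∀ {φ} → InLU φ → ∀ t → toℕ t + ○-depth φ < N →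
               (t , true) ⊩ φ → (t , false) ⊩ φ
  there⇒here (var x) t lt h = h , m+n≤o⇒m≤o (suc (toℕ t)) lt
  there⇒here ⊥' t lt ()
  there⇒here (a ∧' b) t lt (hφ , hψ) =
    there⇒here a t (⊔-left (toℕ t) lt) hφ , there⇒here b t (⊔-right (toℕ t) lt) hψ
  there⇒here (a ∨' b) t lt (inj₁ hφ) = inj₁ (there⇒here a t (⊔-left (toℕ t) lt) hφ)
  there⇒here (a ∨' b) t lt (inj₂ hψ) = inj₂ (there⇒here b t (⊔-right (toℕ t) lt) hψ)
  there⇒here (a ⇒ b) t lt h (.t , true) (refl , f≤t) hφ = h (t , true) (refl , b≤b) hφ
  there⇒here {φ ⇒ ψ} (a ⇒ b) t lt h (.t , false) (refl , b≤b) hφ =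
    there⇒here b t (⊔-right (toℕ t) lt) (h (t , true) (refl , b≤b) (⊨-mono M φ (refl , f≤t) hφ))
  there⇒here {○ φ} (○ a) t lt h = there⇒here a (step t) lt′ h
    where
    lt′ : toℕ (step t) + ○-depth φ < N
    lt′ = ≤-<-trans (+-monoˡ-≤ (○-depth φ) (toℕ-step≤ t)) (subst (_< N) (+-suc (toℕ t) (○-depth φ)) lt)
  there⇒here {φ 𝒰 ψ} (a 𝒰 b) t lt (k , hψ , _) =
    0 , there⇒here b t (⊔-right (toℕ t) lt) ψ-now , λ _ ()
    where
    ψ-now : (t , true) ⊩ ψ
    ψ-now = there-⊩-indep (λ _ _ _ x≡p → x≡p) ψ (iter step k t) t (subst (_⊩ ψ) (iter-S k t true) hψ)

theorem8p1 : (p : Var) →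
    ¬ (Σ Form λ φ → InLU φ ×
        ((n : ℕ) (f : Fin (suc n) → Fin (suc n))
         (V : HTW n → Var → Set)
         (V-mono : ∀ t x → V (t , false) x → V (t , true) x) →
         Valid (HT n f V V-mono) (□ (var p) ⇔ φ)))
theorem8p1 p (φ , φ∈LU , □p⇔φ) = ¬□p-here □p-here
  where
  open CounterModel p (suc (○-depth φ))
  valid : Valid M (□ (var p) ⇔ φ)
  valid = □p⇔φ (suc (○-depth φ)) step V V-mono
  φ-there : (0F , true) ⊩ φ
  φ-there = proj₁ (valid (0F , true)) (0F , true) (refl , b≤b) □p-there
  φ-here : (0F , false) ⊩ φ
  φ-here = there⇒here φ∈LU 0F ≤-refl φ-there
  □p-here : (0F , false) ⊩ □ (var p)
  □p-here = proj₂ (valid (0F , false)) (0F , false) (refl , b≤b) φ-here
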